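{- The assignment sending each set to itself and each $\mathrm{CPM}(\mathbf{Rel})$-morphism $R: A\to B$ to the graph $G(R): A\to B$ with vertex set $\{(a,b)\mid R(a,a,b,b)\}$ and edge set $\{\{(a,b),(a',b')\}\mid R(a,a',b,b')\}$ is an identity-on-objects functor $G:\mathrm{CPM}(\mathbf{Rel})\to\mathcal{G}$.
   Context: $\mathbf{Rel}$: sets and binary relations, dagger the converse relation; a relation $P: X\to X$ is positive if $P=T^\dagger\circ T$ for some relation $T: X\to Y$. $\mathrm{CPM}(\mathbf{Rel})$ has sets as objects; a morphism $A\to B$ is a relation $R\subseteq(A\times A)\times(B\times B)$ such that the relation $\overline{R}$ on $A\times B$, $\overline{R}((a_1,b_1),(a_2,b_2))\iff R(a_2,a_1,b_2,b_1)$, is positive; composition is $(S\circ R)(a,a',c,c')\iff\exists b,b'.\ R(a,a',b,b')\wedge S(b,b',c,c')$ and the identity is $1_A(a_1,a_2,a_3,a_4)\iff a_1=a_3\wedge a_2=a_4$. A graph is a vertex set $W$ with a set $E$ of unordered pairs $\{v,w\}$ of vertices ($v=w$ allowed) such that $\{v\}\in E$ for every $v\in W$. The category $\mathcal{G}$ has sets as objects; a morphism $\gamma: A\to B$ is a graph whose vertex set is a subset of $A\times B$; composition of $\gamma: A\to B$, $\gamma': B\to C$ is given by $V(\gamma'\circ\gamma)=\{(a,c)\mid\exists b.\ (a,b)\in V(\gamma)\wedge(b,c)\in V(\gamma')\}$, $E(\gamma'\circ\gamma)=\{\{(a,c),(a',c')\}\mid\exists b,b'.\ \{(a,b),(a',b')\}\in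 E(\gamma)\wedge\{(b,c),(b',c')\}\in E(\gamma')\}$; the identity $1_A$ is the complete graph on the diagonal $\{(a,a)\mid a\in A\}$. -}

module Defs where

open import Level using (Level)
open import Data.Product using (Σ; ∃; ∃-syntax; _×_; _,_)
open import Function.Bundles using (_⇔_)

Rel : Set → Set → Set₁
Rel X Y = X → Y → Set

_† : {X Y : Set} → Rel X Y → Rel Y X
(T †) y x = T x y

_∘ᵣ_ : {X Y Z : Set} → Rel Y Z → Rel X Y → Rel X Z
(S ∘ᵣ T) x z = ∃[ y ] (T x y × S y z)

IsPositive : {X : Set} → Rel X X → Set₁
IsPositive {X} P =
  Σ Set λ Y → Σ (Rel X Y) λ T → ∀ x x' → P x x' ⇔ ((T †) ∘ᵣ T) x x'

-- R ⊆ (A × A) × (B × B), written R a a' b b'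
Rel₂ : Set → Set → Set₁
Rel₂ A B = A → A → B → B → Set

bar : {A B : Set} → Rel₂ A B → Rel (A × B) (A × B)
bar R (a₁ , b₁) (a₂ , b₂) = R a₂ a₁ b₂ b₁

CPMHom : Set → Set → Set₁
CPMHom A B = Σ (Rel₂ A B) λ R → IsPositive (bar R)

cpmComp : {A B C : Set} → Rel₂ B C → Rel₂ A B → Rel₂ A C
cpmComp S R a a' c c' = ∃[ b ] ∃[ b' ] (R a a' b b' × S b b' c c')

cpmId : (A : Set) → Rel₂ A A
cpmId A a₁ a₂ a₃ a₄ = (a₁ ≡ a₃) × (a₂ ≡ a₄)
  where open import Relation.Binary.PropositionalEquality using (_≡_)

-- The category 𝒢.  A morphism A → B is a graph whose vertex set is a
-- subset of A × B.  The set of unordered pairs E is represented by the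
-- symmetric relation  Edge v w  ⇔  {v,w} ∈ E.

record RawGraph (A B : Set) : Set₁ where
  field
    Vert : A × B → Set
    Edge : A × B → A × B → Set
open RawGraph public

-- the graph axioms: E is a set of unordered pairs of vertices, and
-- contains {v} for every vertex v
record IsGraph {A B : Set} (γ : RawGraph A B) : Set where
  field
    edge-sym  : ∀ v w → Edge γ v w → Edge γ w v
    edge-vertˡ : ∀ v w → Edge γ v w → Vert γ v
    edge-vertʳ : ∀ v w → Edge γ v w → Vert γ w
    loop      : ∀ v → Vert γ v → Edge γ v v

_≈G_ : {A B : Set} → RawGraph A B → RawGraph A B → Set
γ ≈G δ = (∀ v → Vert γ v ⇔ Vert δ v) × (∀ v w → Edge γ v w ⇔ Edge δ v w)

_∘G_ : {A B C : Set} → RawGraph B C → RawGraph A B → RawGraph A C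
Vert (γ' ∘G γ) (a , c) = ∃[ b ] (Vert γ (a , b) × Vert γ' (b , c))
Edge (γ' ∘G γ) (a , c) (a' , c') =
  ∃[ b ] ∃[ b' ] (Edge γ (a , b) (a' , b') × Edge γ' (b , c) (b' , c'))

idG : (A : Set) → RawGraph A A
Vert (idG A) (a , a') = a ≡ a'
  where open import Relation.Binary.PropositionalEquality using (_≡_)
Edge (idG A) (a , a') (b , b') = (a ≡ a') × (b ≡ b')
  where open import Relation.Binary.PropositionalEquality using (_≡_)

G : {A B : Set} → Rel₂ A B → RawGraph A B
Vert (G R) (a , b) = R a a b b
Edge (G R) (a , b) (a' , b') = R a a' b b'

module Submission where

-- Everything rests on two facts about a positive relation P = T† ∘ T on
-- a set X: it is symmetric, and whenever P x x' holds, P x x holds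
-- (both are witnessed by the same T-image y of x and x').  Read through
-- the twist R ↦ R̄, these say that for a CPM(Rel)-morphism R the
-- relation R a a' b b' is symmetric under (a,b) ↔ (a',b') and implies
-- the diagonal instances R a a b b and R a' a' b' b'.  That is exactly
-- the graph axioms for G(R).  Preservation of identities and of edges
-- under composition holds by definition; for vertices of a composite,
-- a middle pair (b, b') with R a a b b' and S b b' c c is replaced by
-- the diagonal pair (b, b) using the diagonal property once more.

open import Defs
open import Data.Product using (Σ; _×_; _,_; proj₁; proj₂)
open import Function.Bundles using (_⇔_; Equivalence; mk⇔)

module Positive {X : Set} {P : Rel X X} (pos : IsPositive P) where
  private
    T : Rel X (proj₁ pos)
    T = proj₁ (proj₂ pos)

    factor : ∀ x x' → P x x' ⇔ ((T †) ∘ᵣ T) x x'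
    factor = proj₂ (proj₂ pos)

  -- A positive relation is symmetric: a common T-image of x and x'
  -- serves in either order.
  sym : ∀ {x x'} → P x x' → P x' x
  sym {x} {x'} p with Equivalence.to (factor x x') p
  ... | y , xTy , x'Ty = Equivalence.from (factor x' x) (y , x'Ty , xTy)

  -- A positive relation relates each element it touches to itself:
  -- x has some T-image, which is then a common image of x and x.
  diagˡ : ∀ {x x'} → P x x' → P x x
  diagˡ {x} {x'} p with Equivalence.to (factor x x') p
  ... | y , xTy , _ = Equivalence.from (factor x x) (y , xTy , xTy)

  diagʳ : ∀ {x x'} → P x x' → P x' x'
  diagʳ p = diagˡ (sym p)

-- The same facts for a CPM(Rel)-morphism, transported along the twist
-- R a a' b b' = R̄ ((a',b'),(a,b)).
module CPM {A B : Set} (R : CPMHom A B) where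
  private
    module P = Positive (proj₂ R)

  sym : ∀ {a a' b b'} → proj₁ R a a' b b' → proj₁ R a' a b' b
  sym = P.sym

  diagˡ : ∀ {a a' b b'} → proj₁ R a a' b b' → proj₁ R a a b b
  diagˡ = P.diagʳ

  diagʳ : ∀ {a a' b b'} → proj₁ R a a' b b' → proj₁ R a' a' b' b'
  diagʳ = P.diagˡ

G-isGraph : {A B : Set} (R : CPMHom A B) → IsGraph (G (proj₁ R))
G-isGraph R = record
  { edge-sym   = λ _ _ → sym
  ; edge-vertˡ = λ _ _ → diagˡ
  ; edge-vertʳ = λ _ _ → diagʳ
  ; loop       = λ _ vertex → vertex
  }
  where open CPM R

G-identity : (A : Set) → G (cpmId A) ≈G idG A
G-identity _ = (λ _ → mk⇔ proj₁ (λ a≡a' → a≡a' , a≡a'))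
             , (λ _ _ → mk⇔ (λ e → e) (λ e → e))

-- G preserves composition.  Edges agree on the nose; a vertex witness
-- (b, b') of the composite is shrunk to the diagonal witness (b, b).
G-composition : {A B C : Set} (R : CPMHom A B) (S : CPMHom B C) →
    G (cpmComp (proj₁ S) (proj₁ R)) ≈G (G (proj₁ S) ∘G G (proj₁ R))
G-composition R S = (λ _ → mk⇔ shrink widen) , (λ _ _ → mk⇔ (λ e → e) (λ e → e))
  where
    shrink : ∀ {a c} → cpmComp (proj₁ S) (proj₁ R) a a c c →
             Σ _ λ b → proj₁ R a a b b × proj₁ S b b c c
    shrink (b , _ , r , s) = b , CPM.diagˡ R r , CPM.diagˡ S s

    widen : ∀ {a c} → (Σ _ λ b → proj₁ R a a b b × proj₁ S b b c c) →
            cpmComp (proj₁ S) (proj₁ R) a a c c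
    widen (b , r , s) = b , b , r , s

proposition4p9 :
    ((A B : Set) → (R : CPMHom A B) → IsGraph (G (proj₁ R)))
    × ((A : Set) → G (cpmId A) ≈G idG A)
    × ((A B C : Set) → (R : CPMHom A B) → (S : CPMHom B C) →
       G (cpmComp (proj₁ S) (proj₁ R)) ≈G (G (proj₁ S) ∘G G (proj₁ R)))
proposition4p9 = (λ _ _ → G-isGraph)
               , G-identity
               , (λ _ _ _ → G-composition)
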